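{- Let $G$ be an edge-colored graph of order $n$. If $e(G)+c(G)\geq \binom{n+1}{2}-1$ and $G$ contains no rainbow triangle, then $G$ belongs to $\mathcal{G}_0$.
   Context: Graphs are finite and simple. An edge-colored graph is a graph $G$ with a map $C:E(G)\to\mathbb{N}$. $e(G)$ is the number of edges of $G$ and $c(G)$ is the number of distinct colors appearing on $E(G)$. A subgraph is rainbow if all its edges have distinct colors; a set of edges is monochromatic if all have the same color. For disjoint $S,S'\subseteq V(G)$, $G[S,S']$ is the bipartite subgraph with classes $S,S'$ and edge set $\{xy\in E(G):x\in S,y\in S'\}$. The class $\mathcal{G}_0$ of edge-colored complete graphs is defined recursively: $K_1\in\mathcal{G}_0$; an edge-colored complete graph $G$ of order $n\geq 2$ belongs to $\mathcal{G}_0$ iff $c(G)=n-1$ and there is a bipartition $V(G)=V_1\cup V_2$ (both nonempty) such that $G[V_1,V_2]$ is monochromatic and $G[V_1],G[V_2]\in\mathcal{G}_0$. -}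

module Defs where

open import Data.Nat using (ℕ; zero; suc; _∸_; _<ᵇ_)
open import Data.Nat.Properties using (_≟_)
open import Data.Fin using (Fin; toℕ)
open import Data.Fin.Subset using (Subset; _∈_; _∪_; Nonempty; ∣_∣; ⊤)
open import Data.Vec using (lookup)
open import Data.Bool using (Bool; true; false; _∧_; if_then_else_)
open import Data.Maybe using (Maybe; just; nothing; maybe)
open import Data.List using (List; []; _∷_; length; concatMap; deduplicate; allFin)
open import Data.Product using (Σ; ∃; _×_; _,_)
open import Data.Empty using (⊥)
open import Relation.Nullary using (¬_)
open import Relation.Binary.PropositionalEquality using (_≡_; _≢_)

-- An edge-colored simple graph on vertex set Fin n.
-- col x y ≡ nothing : no edge xy ;  col x y ≡ just a : edge xy with color a.
record ECGraph (n : ℕ) : Set where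
  field
    col     : Fin n → Fin n → Maybe ℕ
    col-sym : ∀ x y → col x y ≡ col y x
    col-irr : ∀ x → col x x ≡ nothing
open ECGraph public

-- list of colors of the edges of the induced subgraph G[S],
-- one entry per edge {x,y} (counted once, via toℕ x < toℕ y)
edgeColorsIn : ∀ {n} → ECGraph n → Subset n → List ℕ
edgeColorsIn {n} G S =
  concatMap (λ x → concatMap (λ y →
     if (toℕ x <ᵇ toℕ y) ∧ lookup S x ∧ lookup S y
       then maybe (λ a → a ∷ []) [] (col G x y)
       else []) (allFin n)) (allFin n)

eIn : ∀ {n} → ECGraph n → Subset n → ℕ
eIn G S = length (edgeColorsIn G S)

cIn : ∀ {n} → ECGraph n → Subset n → ℕ
cIn G S = length (deduplicate _≟_ (edgeColorsIn G S))

e : ∀ {n} → ECGraph n → ℕ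
e G = eIn G ⊤

c : ∀ {n} → ECGraph n → ℕ
c G = cIn G ⊤

RainbowTriangle : ∀ {n} → ECGraph n → Set
RainbowTriangle {n} G =
  Σ (Fin n) λ x → Σ (Fin n) λ y → Σ (Fin n) λ z →
  Σ ℕ λ a → Σ ℕ λ b → Σ ℕ λ d →
    col G x y ≡ just a × col G y z ≡ just b × col G x z ≡ just d ×
    a ≢ b × b ≢ d × a ≢ d

CompleteOn : ∀ {n} → ECGraph n → Subset n → Set
CompleteOn {n} G S = ∀ (x y : Fin n) → x ∈ S → y ∈ S → x ≢ y → Σ ℕ λ a → col G x y ≡ just a

Disjoint : ∀ {n} → Subset n → Subset n → Set
Disjoint {n} S T = ∀ (x : Fin n) → x ∈ S → x ∈ T → ⊥

MonoBetween : ∀ {n} → ECGraph n → Subset n → Subset n → Set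
MonoBetween {n} G S T = Σ ℕ λ a → ∀ (x y : Fin n) → x ∈ S → y ∈ T → col G x y ≡ just a

data InG0 {n : ℕ} (G : ECGraph n) : Subset n → Set where
  single : ∀ {S} → ∣ S ∣ ≡ 1 → InG0 G S
  split  : ∀ {S} (S₁ S₂ : Subset n) →
           CompleteOn G S →
           cIn G S ≡ ∣ S ∣ ∸ 1 →
           Nonempty S₁ → Nonempty S₂ → Disjoint S₁ S₂ → S₁ ∪ S₂ ≡ S →
           MonoBetween G S₁ S₂ →
           InG0 G S₁ → InG0 G S₂ → InG0 G S

InG0Graph : ∀ {n} → ECGraph n → Set
InG0Graph G = InG0 G ⊤

-- Deleting a vertex v from G[S] loses at most deg v edges and k(v) colors, where k(v) counts the
-- colors seen at v but nowhere in G[S - v]. Two edges vy₁, vy₂ with distinct such private colors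
-- force y₁, y₂ to be non-adjacent (otherwise v y₁ y₂ is rainbow), so k(v) is at most the number
-- of non-neighbors of some vertex; deleting a vertex of maximal non-degree costs at most ∣ S ∣,
-- and induction gives e + c ≤ (n + 1 choose 2) - 1. In the equality case every deletion is tight,
-- which forces G to be complete with exactly n - 1 colors. Such a graph splits: for a private
-- color p at v, every vertex outside the p-neighborhood N of v sees N in the color in which it
-- sees v, so a split of the rest A (again with ∣ A ∣ - 1 colors) extends by adding N to the side
-- containing v.

module Submission where

open import Algebra.Properties.CommutativeSemigroup using (interchange)
open import Data.Bool using (Bool; true; false; T; not; _∧_; if_then_else_)
open import Data.Bool.Properties using (T-∧; T-≡; T-not-≡)
open import Data.Empty using (⊥-elim)
open import Data.Fin using (Fin; zero; suc; toℕ)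
open import Data.Fin.Properties using (0≢1+n; toℕ-injective)
  renaming (_≟_ to _≟ᶠ_; suc-injective to Fin-suc-injective)
open import Data.Fin.Subset
  using (Subset; inside; outside; _∈_; _∉_; _⊆_; _∪_; _∩_; _─_; _-_; ⁅_⁆; ∣_∣; Nonempty; ⊤)
open import Data.Fin.Subset.Properties
  using (_∈?_; x∈⁅x⁆; x∈⁅y⁆⇒x≡y; ∣⁅x⁆∣≡1; ∣⊤∣≡n; ⊆-antisym; ∪-comm; x∈p∪q⁻; x∈p∪q⁺; x∈p∩q⁺; x∈p∩q⁻;
         x∈p∧x∉q⇒x∈p─q; p─q⊆p; x∈p∧x≢y⇒x∈p-y; x∈p⇒∣p-x∣<∣p∣)
open import Data.List
  using (List; []; _∷_; length; map; filter; _++_; deduplicate; concatMap; allFin; cartesianProduct; find)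
open import Data.List.Extrema.Nat using (argmax; argmax-all; f[xs]≤f[argmax])
open import Data.List.Membership.Propositional
  using (lose) renaming (find to find-∈; _∈_ to _∈ₗ_; _∉_ to _∉ₗ_; _─_ to _─ₗ_)
open import Data.List.Membership.Propositional.Properties
  using (∈-++⁺ˡ; ∈-++⁺ʳ; ∈-++⁻; ∈-map⁺; ∈-map⁻; ∈-deduplicate⁺; ∈-deduplicate⁻; ∈-concatMap⁺; ∈-concatMap⁻;
         ∈-allFin; ∈-filter⁺; ∈-filter⁻; ∈-cartesianProduct⁺)
open import Data.List.Properties using (length-++; length-map; length-removeAt′; filter-++)
open import Data.List.Relation.Binary.Subset.Propositional using () renaming (_⊆_ to _⊆ₗ_)
open import Data.List.Relation.Unary.All using ([]; _∷_) renaming (lookup to All-lookup; tabulate to All-tabulate)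
open import Data.List.Relation.Unary.AllPairs using ([]; _∷_)
open import Data.List.Relation.Unary.Any using (Any; here; there; index; satisfied)
open import Data.List.Relation.Unary.Unique.DecPropositional.Properties using (deduplicate-!)
open import Data.List.Relation.Unary.Unique.Propositional using (Unique)
import Data.List.Relation.Unary.Unique.Propositional.Properties as Unique
open import Data.Maybe using (just; nothing; maybe; is-just)
open import Data.Maybe.Properties using (just-injective) renaming (≡-dec to ≡-dec-Maybe)
open import Data.Nat using (ℕ; zero; suc; _+_; _∸_; _≤_; _≥_; _<_; _<ᵇ_; z≤n; s≤s)
open import Data.Nat.Combinatorics using (_C_; nC1≡n; nCk+nC[k+1]≡[n+1]C[k+1])
open import Data.Nat.Induction using (<-wellFounded)
open import Data.Nat.Properties
  using (_≟_; _≤?_; suc-injective; ≤-reflexive; ≤-trans; ≤-antisym; ≤-pred; ≤-<-trans; ≤∧≢⇒<; ≰⇒>; <-cmp; <-irrefl;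
         <-asym; <ᵇ⇒<; <⇒<ᵇ; +-comm; +-suc; +-identityʳ; +-mono-≤; +-monoˡ-≤; +-monoʳ-≤; +-mono-≤-<;
         +-cancelˡ-≡; +-cancelˡ-≤; +-cancelʳ-≤; +-commutativeSemigroup; module ≤-Reasoning)
open import Data.List.Membership.DecPropositional _≟_ using () renaming (_∈?_ to _∈ₗ?_)
open import Data.Product using (∃; _×_; _,_; proj₁; proj₂; uncurry)
open import Data.Sum using (_⊎_; inj₁; inj₂; [_,_]′; swap) renaming (map₁ to ⊎-map₁)
open import Data.Vec using ([]; _∷_; here; there; lookup; tabulate)
open import Data.Vec.Properties using ([]=⇒lookup; lookup⇒[]=; lookup∘tabulate)
open import Function using (id; _∘_)
open import Function.Bundles using (Equivalence)
open import Induction.WellFounded using (Acc; acc)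
open import Level using (0ℓ)
open import Relation.Binary using (tri<; tri≈; tri>)
open import Relation.Binary.PropositionalEquality
  using (_≡_; _≢_; refl; sym; trans; cong; cong₂; subst; subst₂; ≢-sym; module ≡-Reasoning)
open import Relation.Nullary using (¬_; yes; no)
open import Relation.Nullary.Decidable using (T?; ¬?; isYes; fromWitness; toWitness)
open import Relation.Unary using (Pred; Decidable)

open import Defs

∈-─ₗ⁺ : ∀ {A : Set} {x y : A} {xs : List A} (x∈xs : x ∈ₗ xs) → y ∈ₗ xs → y ≢ x → y ∈ₗ xs ─ₗ x∈xs
∈-─ₗ⁺ (here refl) (here refl) y≢x = ⊥-elim (y≢x refl)
∈-─ₗ⁺ (here _)    (there y∈)  _   = y∈
∈-─ₗ⁺ (there _)   (here refl) _   = here refl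
∈-─ₗ⁺ (there x∈)  (there y∈)  y≢x = there (∈-─ₗ⁺ x∈ y∈ y≢x)

length-≤-injection : ∀ {A B : Set} (f : A → B) {xs : List A} {ys : List B} → Unique xs →
  (∀ {a b} → a ∈ₗ xs → b ∈ₗ xs → f a ≡ f b → a ≡ b) → (∀ {a} → a ∈ₗ xs → f a ∈ₗ ys) →
  length xs ≤ length ys
length-≤-injection f {[]}     _              _   _    = z≤n
length-≤-injection f {x ∷ xs} {ys} (x∉xs ∷ !xs) inj into =
  subst (suc (length xs) ≤_) (sym (length-removeAt′ ys (index fx∈ys)))
    (s≤s (length-≤-injection f !xs (λ a∈ b∈ → inj (there a∈) (there b∈)) into′))
  where
  fx∈ys = into (here refl)
  into′ : ∀ {a} → a ∈ₗ xs → f a ∈ₗ ys ─ₗ fx∈ys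
  into′ a∈ = ∈-─ₗ⁺ fx∈ys (into (there a∈)) (λ fa≡fx → All-lookup x∉xs a∈ (inj (here refl) (there a∈) (sym fa≡fx)))

length-≤-⊆ : ∀ {A : Set} {xs ys : List A} → Unique xs → xs ⊆ₗ ys → length xs ≤ length ys
length-≤-⊆ !xs xs⊆ys = length-≤-injection id !xs (λ _ _ → id) xs⊆ys

distinct : List ℕ → ℕ
distinct xs = length (deduplicate _≟_ xs)

distinct-mono : ∀ {xs ys} → xs ⊆ₗ ys → distinct xs ≤ distinct ys
distinct-mono {xs} xs⊆ys =
  length-≤-⊆ (deduplicate-! _≟_ xs) (∈-deduplicate⁺ _≟_ ∘ xs⊆ys ∘ ∈-deduplicate⁻ _≟_ xs)

distinct-++ : ∀ xs ys → distinct (xs ++ ys) ≤ distinct xs + distinct ys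
distinct-++ xs ys = subst (distinct (xs ++ ys) ≤_) (length-++ (deduplicate _≟_ xs))
  (length-≤-⊆ (deduplicate-! _≟_ (xs ++ ys)) λ z∈ →
    [ (λ z∈xs → ∈-++⁺ˡ (∈-deduplicate⁺ _≟_ z∈xs)) , (λ z∈ys → ∈-++⁺ʳ _ (∈-deduplicate⁺ _≟_ z∈ys)) ]′
      (∈-++⁻ xs (∈-deduplicate⁻ _≟_ (xs ++ ys) z∈)))

∈-concatMap₂⁺ : ∀ {n} {A : Set} (f : Fin n → Fin n → List A) {x y a} → a ∈ₗ f x y →
  a ∈ₗ concatMap (λ x → concatMap (f x) (allFin n)) (allFin n)
∈-concatMap₂⁺ {n} f {x} {y} a∈ =
  ∈-concatMap⁺ (λ x → concatMap (f x) (allFin n)) (lose (∈-allFin x) (∈-concatMap⁺ (f x) (lose (∈-allFin y) a∈)))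

∈-concatMap₂⁻ : ∀ {n} {A : Set} (f : Fin n → Fin n → List A) {a} →
  a ∈ₗ concatMap (λ x → concatMap (f x) (allFin n)) (allFin n) → ∃ λ x → ∃ λ y → a ∈ₗ f x y
∈-concatMap₂⁻ {n} f a∈ =
  let x , a∈ₓ = satisfied (∈-concatMap⁻ (λ x → concatMap (f x) (allFin n)) {xs = allFin n} a∈)
      y , a∈ₓᵧ = satisfied (∈-concatMap⁻ (f x) {xs = allFin n} a∈ₓ)
  in x , y , a∈ₓᵧ

length-filter-T?+length-filter-not : ∀ {A : Set} (p : A → Bool) xs →
  length (filter (T? ∘ p) xs) + length (filter (T? ∘ not ∘ p) xs) ≡ length xs
length-filter-T?+length-filter-not p []       = refl
length-filter-T?+length-filter-not p (x ∷ xs) with p x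
... | true  = cong suc (length-filter-T?+length-filter-not p xs)
... | false = trans (+-suc _ _) (cong suc (length-filter-T?+length-filter-not p xs))

length-concatMap₂≡length-filter : ∀ {A B C : Set} (p : A → B → Bool) (f : A → B → List C) →
  (∀ a b → length (f a b) ≡ (if p a b then 1 else 0)) → ∀ xs ys →
  length (concatMap (λ a → concatMap (f a) ys) xs) ≡ length (filter (T? ∘ uncurry p) (cartesianProduct xs ys))
length-concatMap₂≡length-filter p f ∣f∣ []       ys = refl
length-concatMap₂≡length-filter p f ∣f∣ (x ∷ xs) ys = begin
  length (concatMap (f x) ys ++ concatMap (λ a → concatMap (f a) ys) xs)
    ≡⟨ length-++ (concatMap (f x) ys) ⟩
  length (concatMap (f x) ys) + length (concatMap (λ a → concatMap (f a) ys) xs)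
    ≡⟨ cong₂ _+_ (row ys) (length-concatMap₂≡length-filter p f ∣f∣ xs ys) ⟩
  length (filter P? (map (x ,_) ys)) + length (filter P? (cartesianProduct xs ys))
    ≡⟨ sym (length-++ (filter P? (map (x ,_) ys))) ⟩
  length (filter P? (map (x ,_) ys) ++ filter P? (cartesianProduct xs ys))
    ≡⟨ cong length (sym (filter-++ P? (map (x ,_) ys) (cartesianProduct xs ys))) ⟩
  length (filter P? (cartesianProduct (x ∷ xs) ys)) ∎
  where
  open ≡-Reasoning
  P? = T? ∘ uncurry p
  row : ∀ ys → length (concatMap (f x) ys) ≡ length (filter P? (map (x ,_) ys))
  row []       = refl
  row (y ∷ ys) rewrite length-++ (f x y) {concatMap (f x) ys} | ∣f∣ x y with p x y
  ... | true  = cong suc (row ys)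
  ... | false = row ys

find-just : ∀ {A : Set} {P : Pred A 0ℓ} (P? : Decidable P) {xs} → Any P xs →
  ∃ λ y → find P? xs ≡ just y × y ∈ₗ xs × P y
find-just P? {x ∷ xs} any with P? x | any
... | yes Px | _          = x , refl , here refl , Px
... | no ¬Px | here Px    = ⊥-elim (¬Px Px)
... | no _   | there any′ = let y , eq , y∈ , Py = find-just P? any′ in y , eq , there y∈ , Py

members : ∀ {n} → Subset n → List (Fin n)
members []            = []
members (inside ∷ S)  = zero ∷ map suc (members S)
members (outside ∷ S) = map suc (members S)

length-members : ∀ {n} (S : Subset n) → length (members S) ≡ ∣ S ∣
length-members []            = refl
length-members (inside ∷ S)  = cong suc (trans (length-map suc (members S)) (length-members S))
length-members (outside ∷ S) = trans (length-map suc (members S)) (length-members S)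

∈-members⁺ : ∀ {n} {S : Subset n} {x} → x ∈ S → x ∈ₗ members S
∈-members⁺ {S = inside ∷ _}  here       = here refl
∈-members⁺ {S = inside ∷ _}  (there x∈) = there (∈-map⁺ suc (∈-members⁺ x∈))
∈-members⁺ {S = outside ∷ _} (there x∈) = ∈-map⁺ suc (∈-members⁺ x∈)

∈-members⁻ : ∀ {n} {S : Subset n} {x} → x ∈ₗ members S → x ∈ S
∈-members⁻ {S = inside ∷ _} (here refl) = here
∈-members⁻ {S = inside ∷ S} (there x∈) with ∈-map⁻ suc x∈
... | _ , y∈ , refl = there (∈-members⁻ y∈)
∈-members⁻ {S = outside ∷ S} x∈ with ∈-map⁻ suc x∈
... | _ , y∈ , refl = there (∈-members⁻ y∈)

members-unique : ∀ {n} (S : Subset n) → Unique (members S)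
members-unique []            = []
members-unique (inside ∷ S)  =
  All-tabulate (λ y∈ 0≡y → let (_ , _ , y≡) = ∈-map⁻ suc y∈ in 0≢1+n (trans 0≡y y≡))
  ∷ Unique.map⁺ Fin-suc-injective (members-unique S)
members-unique (outside ∷ S) = Unique.map⁺ Fin-suc-injective (members-unique S)

Unique⇒length≤∣∣ : ∀ {n} {xs : List (Fin n)} {S} → Unique xs → (∀ {x} → x ∈ₗ xs → x ∈ S) → length xs ≤ ∣ S ∣
Unique⇒length≤∣∣ {S = S} !xs xs⊆S =
  subst (_ ≤_) (length-members S) (length-≤-⊆ !xs (∈-members⁺ ∘ xs⊆S))

∣∣≤length : ∀ {n} {S : Subset n} {xs} → (∀ {x} → x ∈ S → x ∈ₗ xs) → ∣ S ∣ ≤ length xs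
∣∣≤length {S = S} S⊆xs =
  subst (_≤ _) (length-members S) (length-≤-⊆ (members-unique S) (S⊆xs ∘ ∈-members⁻))

∣p∪q∣≤∣p∣+∣q∣ : ∀ {n} (p q : Subset n) → ∣ p ∪ q ∣ ≤ ∣ p ∣ + ∣ q ∣
∣p∪q∣≤∣p∣+∣q∣ p q =
  subst (∣ p ∪ q ∣ ≤_) (trans (length-++ (members p)) (cong₂ _+_ (length-members p) (length-members q)))
    (∣∣≤length λ x∈ → [ ∈-++⁺ˡ ∘ ∈-members⁺ , ∈-++⁺ʳ _ ∘ ∈-members⁺ ]′ (x∈p∪q⁻ p q x∈))

Disjoint⇒∣p∣+∣q∣≤∣r∣ : ∀ {n} {p q r : Subset n} → Disjoint p q → p ⊆ r → q ⊆ r → ∣ p ∣ + ∣ q ∣ ≤ ∣ r ∣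
Disjoint⇒∣p∣+∣q∣≤∣r∣ {p = p} {q} disj p⊆r q⊆r =
  subst (_≤ _) (trans (length-++ (members p)) (cong₂ _+_ (length-members p) (length-members q)))
    (Unique⇒length≤∣∣
      (Unique.++⁺ (members-unique p) (members-unique q)
        (λ (x∈p , x∈q) → disj _ (∈-members⁻ x∈p) (∈-members⁻ x∈q)))
      (λ x∈ → [ p⊆r ∘ ∈-members⁻ , q⊆r ∘ ∈-members⁻ ]′ (∈-++⁻ (members p) x∈)))

x∈p⇒1≤∣p∣ : ∀ {n} {p : Subset n} {x} → x ∈ p → 1 ≤ ∣ p ∣
x∈p⇒1≤∣p∣ x∈p = Unique⇒length≤∣∣ ([] ∷ []) λ { (here refl) → x∈p }

x≢y⇒2≤∣p∣ : ∀ {n} {p : Subset n} {x y} → x ≢ y → x ∈ p → y ∈ p → 2 ≤ ∣ p ∣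
x≢y⇒2≤∣p∣ x≢y x∈p y∈p =
  Unique⇒length≤∣∣ ((x≢y ∷ []) ∷ [] ∷ []) λ { (here refl) → x∈p ; (there (here refl)) → y∈p }

0<∣p∣⇒Nonempty : ∀ {n} {p : Subset n} → 0 < ∣ p ∣ → Nonempty p
0<∣p∣⇒Nonempty {p = p} 0<∣p∣ with members p | length-members p | ∈-members⁻ {S = p}
... | x ∷ _ | _     | ∈p = x , ∈p (here refl)
... | []    | 0≡∣p∣ | _  = ⊥-elim (<-irrefl 0≡∣p∣ 0<∣p∣)

∣p∣≡suc⇒Nonempty : ∀ {n} {p : Subset n} {s} → ∣ p ∣ ≡ suc s → Nonempty p
∣p∣≡suc⇒Nonempty {p = p} ∣p∣≡ = 0<∣p∣⇒Nonempty {p = p} (subst (0 <_) (sym ∣p∣≡) (s≤s z≤n))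

x∈p─q⇒x∉q : ∀ {n} {p q : Subset n} {x} → x ∈ p ─ q → x ∉ q
x∈p─q⇒x∉q {p = inside ∷ _}  {outside ∷ _} here        ()
x∈p─q⇒x∉q {p = _ ∷ _}       {_ ∷ _}       (there x∈) (there x∈q) = x∈p─q⇒x∉q x∈ x∈q

p∪q≡r : ∀ {n} {p q r : Subset n} → p ⊆ r → q ⊆ r → (∀ {x} → x ∈ r → x ∈ p ⊎ x ∈ q) → p ∪ q ≡ r
p∪q≡r {p = p} {q} p⊆r q⊆r r⊆p∪q = ⊆-antisym (λ x∈ → [ p⊆r , q⊆r ]′ (x∈p∪q⁻ p q x∈)) (x∈p∪q⁺ ∘ r⊆p∪q)

x∈p⇒suc∣p-x∣≡∣p∣ : ∀ {n} {p : Subset n} {x} → x ∈ p → suc ∣ p - x ∣ ≡ ∣ p ∣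
x∈p⇒suc∣p-x∣≡∣p∣ {p = p} {x} x∈p = ≤-antisym (x∈p⇒∣p-x∣<∣p∣ x∈p)
  (subst (∣ p ∣ ≤_) (cong suc (length-members (p - x))) (∣∣≤length p⊆x∷p-x))
  where
  p⊆x∷p-x : ∀ {y} → y ∈ p → y ∈ₗ x ∷ members (p - x)
  p⊆x∷p-x {y} y∈p with y ≟ᶠ x
  ... | yes refl = here refl
  ... | no  y≢x  = there (∈-members⁺ (x∈p∧x≢y⇒x∈p-y y∈p y≢x))

∣p∣≡suc⇒∣p-x∣≡ : ∀ {n} {p : Subset n} {x s} → x ∈ p → ∣ p ∣ ≡ suc s → ∣ p - x ∣ ≡ s
∣p∣≡suc⇒∣p-x∣≡ x∈p ∣p∣≡ = suc-injective (trans (x∈p⇒suc∣p-x∣≡∣p∣ x∈p) ∣p∣≡)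

∈⇒T-lookup : ∀ {n} {S : Subset n} {x} → x ∈ S → T (lookup S x)
∈⇒T-lookup x∈S = Equivalence.from T-≡ ([]=⇒lookup x∈S)

T-lookup⇒∈ : ∀ {n} {S : Subset n} {x} → T (lookup S x) → x ∈ S
T-lookup⇒∈ {S = S} {x} t = lookup⇒[]= x S (Equivalence.to T-≡ t)

triangular : ℕ → ℕ
triangular zero    = 0
triangular (suc m) = suc m + triangular m

triangular≡C : ∀ m → triangular m ≡ suc m C 2
triangular≡C zero    = refl
triangular≡C (suc m) = trans (cong₂ _+_ (sym (nC1≡n (suc m))) (triangular≡C m)) (nCk+nC[k+1]≡[n+1]C[k+1] (suc m) 1)

+-tight : ∀ {a b A B} → a ≤ A → b ≤ B → A + B ≤ a + b → a ≡ A × b ≡ B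
+-tight {a} {b} {A} {B} a≤A b≤B A+B≤a+b =
  ≤-antisym a≤A (+-cancelʳ-≤ B A a (≤-trans A+B≤a+b (+-monoʳ-≤ a b≤B))) ,
  ≤-antisym b≤B (+-cancelˡ-≤ A B b (≤-trans A+B≤a+b (+-monoˡ-≤ b a≤A)))

-- Edges and colors of an induced subgraph

module _ {n : ℕ} (G : ECGraph n) where

  orderedIn : Subset n → Fin n → Fin n → Bool
  orderedIn S x y = (toℕ x <ᵇ toℕ y) ∧ lookup S x ∧ lookup S y

  orderedIn⁺ : ∀ {S x y} → toℕ x < toℕ y → x ∈ S → y ∈ S → T (orderedIn S x y)
  orderedIn⁺ x<y x∈S y∈S =
    Equivalence.from T-∧ (<⇒<ᵇ x<y , Equivalence.from T-∧ (∈⇒T-lookup x∈S , ∈⇒T-lookup y∈S))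

  orderedIn⁻ : ∀ {S x y} → T (orderedIn S x y) → toℕ x < toℕ y × x ∈ S × y ∈ S
  orderedIn⁻ {x = x} {y} t =
    let x<y , t′ = Equivalence.to T-∧ t ; x∈ , y∈ = Equivalence.to T-∧ t′
    in <ᵇ⇒< (toℕ x) (toℕ y) x<y , T-lookup⇒∈ x∈ , T-lookup⇒∈ y∈

  colorEntry : Subset n → Fin n → Fin n → List ℕ
  colorEntry S x y = if orderedIn S x y then maybe (λ a → a ∷ []) [] (col G x y) else []

  ∈-colorEntry⁻ : ∀ {S x y a} → a ∈ₗ colorEntry S x y → T (orderedIn S x y) × col G x y ≡ just a
  ∈-colorEntry⁻ {S} {x} {y} a∈ with orderedIn S x y | col G x y
  ... | true | just _ with here refl ← a∈ = _ , refl

  ∈-colorEntry⁺ : ∀ {S x y a} → toℕ x < toℕ y → x ∈ S → y ∈ S → col G x y ≡ just a → a ∈ₗ colorEntry S x y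
  ∈-colorEntry⁺ {S} {x} {y} x<y x∈S y∈S xy≡a rewrite xy≡a with orderedIn S x y | orderedIn⁺ {S} x<y x∈S y∈S
  ... | true | _ = here refl

  ∈-edgeColorsIn⁺ : ∀ {S x y a} → x ∈ S → y ∈ S → x ≢ y → col G x y ≡ just a → a ∈ₗ edgeColorsIn G S
  ∈-edgeColorsIn⁺ {S} {x} {y} x∈S y∈S x≢y xy≡a with <-cmp (toℕ x) (toℕ y)
  ... | tri< x<y _ _ = ∈-concatMap₂⁺ (colorEntry S) (∈-colorEntry⁺ x<y x∈S y∈S xy≡a)
  ... | tri≈ _ x≡y _ = ⊥-elim (x≢y (toℕ-injective x≡y))
  ... | tri> _ _ y<x = ∈-concatMap₂⁺ (colorEntry S) (∈-colorEntry⁺ y<x y∈S x∈S (trans (col-sym G y x) xy≡a))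

  ∈-edgeColorsIn⁻ : ∀ {S a} → a ∈ₗ edgeColorsIn G S →
    ∃ λ x → ∃ λ y → x ∈ S × y ∈ S × x ≢ y × col G x y ≡ just a
  ∈-edgeColorsIn⁻ {S} a∈ =
    let x , y , a∈ₓᵧ = ∈-concatMap₂⁻ (colorEntry S) a∈
        ordered , xy≡a = ∈-colorEntry⁻ {S} a∈ₓᵧ
        x<y , x∈S , y∈S = orderedIn⁻ {S} ordered
    in x , y , x∈S , y∈S , (λ x≡y → <-irrefl (cong toℕ x≡y) x<y) , xy≡a

  isEdgeIn : Subset n → Fin n → Fin n → Bool
  isEdgeIn S x y = orderedIn S x y ∧ is-just (col G x y)

  edgesIn : Subset n → List (Fin n × Fin n)
  edgesIn S = filter (T? ∘ uncurry (isEdgeIn S)) (cartesianProduct (allFin n) (allFin n))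

  eIn≡length-edgesIn : ∀ S → eIn G S ≡ length (edgesIn S)
  eIn≡length-edgesIn S =
    length-concatMap₂≡length-filter (isEdgeIn S) (colorEntry S) length-colorEntry (allFin n) (allFin n)
    where
    length-colorEntry : ∀ x y → length (colorEntry S x y) ≡ (if isEdgeIn S x y then 1 else 0)
    length-colorEntry x y with orderedIn S x y | col G x y
    ... | true  | just _  = refl
    ... | true  | nothing = refl
    ... | false | _       = refl

  ∈-edgesIn⁻ : ∀ {S x y} → (x , y) ∈ₗ edgesIn S → T (orderedIn S x y) × T (is-just (col G x y))
  ∈-edgesIn⁻ {S} e∈ = Equivalence.to T-∧
    (proj₂ (∈-filter⁻ (T? ∘ uncurry (isEdgeIn S)) {xs = cartesianProduct (allFin n) (allFin n)} e∈))

  ∈-edgesIn⁺ : ∀ {S x y} → T (orderedIn S x y) → T (is-just (col G x y)) → (x , y) ∈ₗ edgesIn S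
  ∈-edgesIn⁺ {S} {x} {y} ordered adjacent = ∈-filter⁺ (T? ∘ uncurry (isEdgeIn S))
    (∈-cartesianProduct⁺ (∈-allFin x) (∈-allFin y)) (Equivalence.from T-∧ (ordered , adjacent))

  edgesIn-unique : ∀ S → Unique (edgesIn S)
  edgesIn-unique S = Unique.filter⁺ (T? ∘ uncurry (isEdgeIn S))
    (Unique.cartesianProduct⁺ (Unique.allFin⁺ n) (Unique.allFin⁺ n))

  neighborsIn : Subset n → Fin n → List (Fin n)
  neighborsIn S v = filter (T? ∘ is-just ∘ col G v) (members S)

  nonNeighborsIn : Subset n → Fin n → List (Fin n)
  nonNeighborsIn S v = filter (T? ∘ not ∘ is-just ∘ col G v) (members S)

  degreeIn : Subset n → Fin n → ℕ
  degreeIn S v = length (neighborsIn S v)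

  -- counts v itself, as col G v v ≡ nothing
  nonDegreeIn : Subset n → Fin n → ℕ
  nonDegreeIn S v = length (nonNeighborsIn S v)

  degreeIn+nonDegreeIn≡∣S∣ : ∀ S v → degreeIn S v + nonDegreeIn S v ≡ ∣ S ∣
  degreeIn+nonDegreeIn≡∣S∣ S v =
    trans (length-filter-T?+length-filter-not (is-just ∘ col G v) (members S)) (length-members S)

  ∈-nonNeighborsIn⁺ : ∀ {S v y} → y ∈ S → col G v y ≡ nothing → y ∈ₗ nonNeighborsIn S v
  ∈-nonNeighborsIn⁺ {v = v} y∈S vy≡nothing =
    ∈-filter⁺ (T? ∘ not ∘ is-just ∘ col G v) (∈-members⁺ y∈S) (Equivalence.from T-not-≡ (cong is-just vy≡nothing))

  sortedPair : Fin n → Fin n → Fin n × Fin n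
  sortedPair x y = if toℕ x <ᵇ toℕ y then (x , y) else (y , x)

  sortedPair-< : ∀ {x y} → toℕ x < toℕ y → sortedPair x y ≡ (x , y)
  sortedPair-< {x} {y} x<y with toℕ x <ᵇ toℕ y | <⇒<ᵇ x<y
  ... | true | _ = refl

  sortedPair-> : ∀ {x y} → toℕ y < toℕ x → sortedPair x y ≡ (y , x)
  sortedPair-> {x} {y} y<x with toℕ x <ᵇ toℕ y | <ᵇ⇒< (toℕ x) (toℕ y)
  ... | true  | x<y = ⊥-elim (<-asym y<x (x<y _))
  ... | false | _   = refl

  edgesIn-delete : ∀ S v → edgesIn S ⊆ₗ edgesIn (S - v) ++ map (sortedPair v) (neighborsIn S v)
  edgesIn-delete S v {x , y} e∈ with ∈-edgesIn⁻ {S} e∈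
  ... | ordered , adjacent with orderedIn⁻ {S} ordered | x ≟ᶠ v | y ≟ᶠ v
  ... | x<y , _ , y∈S | yes refl | _ = ∈-++⁺ʳ _ (subst (_∈ₗ _) (sortedPair-< x<y)
        (∈-map⁺ (sortedPair v) (∈-filter⁺ (T? ∘ is-just ∘ col G v) (∈-members⁺ y∈S) adjacent)))
  ... | x<y , x∈S , _ | no _ | yes refl = ∈-++⁺ʳ _ (subst (_∈ₗ _) (sortedPair-> x<y)
        (∈-map⁺ (sortedPair v) (∈-filter⁺ (T? ∘ is-just ∘ col G v) (∈-members⁺ x∈S)
          (subst (T ∘ is-just) (col-sym G x v) adjacent))))
  ... | x<y , x∈S , y∈S | no x≢v | no y≢v = ∈-++⁺ˡ (∈-edgesIn⁺ {S - v}
        (orderedIn⁺ x<y (x∈p∧x≢y⇒x∈p-y x∈S x≢v) (x∈p∧x≢y⇒x∈p-y y∈S y≢v)) adjacent)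

  eIn-delete : ∀ S v → eIn G S ≤ eIn G (S - v) + degreeIn S v
  eIn-delete S v = subst₂ _≤_ (sym (eIn≡length-edgesIn S))
    (trans (length-++ (edgesIn (S - v)))
      (cong₂ _+_ (sym (eIn≡length-edgesIn (S - v))) (length-map (sortedPair v) (neighborsIn S v))))
    (length-≤-⊆ (edgesIn-unique S) (edgesIn-delete S v))

  colorsAt : Subset n → Fin n → List ℕ
  colorsAt S v = concatMap (λ y → maybe (λ a → a ∷ []) [] (col G v y)) (members S)

  ∈-colorsAt⁺ : ∀ {S v y a} → y ∈ S → col G v y ≡ just a → a ∈ₗ colorsAt S v
  ∈-colorsAt⁺ {v = v} y∈S vy≡a = ∈-concatMap⁺ (λ y → maybe (λ a → a ∷ []) [] (col G v y))
    (lose (∈-members⁺ y∈S) (subst (λ c → _ ∈ₗ maybe (λ a → a ∷ []) [] c) (sym vy≡a) (here refl)))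

  ∈-colorsAt⁻ : ∀ {S v a} → a ∈ₗ colorsAt S v → ∃ λ y → y ∈ S × col G v y ≡ just a
  ∈-colorsAt⁻ {S} {v} a∈ with find-∈ (∈-concatMap⁻ (λ y → maybe (λ a → a ∷ []) [] (col G v y)) {xs = members S} a∈)
  ... | y , y∈ , a∈ᵧ with col G v y in vy≡
  ...   | just _ with here refl ← a∈ᵧ = y , ∈-members⁻ y∈ , vy≡

  privateColorsAt : Subset n → Fin n → List ℕ
  privateColorsAt S v = deduplicate _≟_ (filter (λ a → ¬? (a ∈ₗ? edgeColorsIn G (S - v))) (colorsAt S v))

  privateColorsAt-unique : ∀ S v → Unique (privateColorsAt S v)
  privateColorsAt-unique S v = deduplicate-! _≟_ _

  ∈-privateColorsAt⁻ : ∀ {S v a} → a ∈ₗ privateColorsAt S v → a ∈ₗ colorsAt S v × a ∉ₗ edgeColorsIn G (S - v)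
  ∈-privateColorsAt⁻ {S} {v} a∈ = ∈-filter⁻ (λ a → ¬? (a ∈ₗ? edgeColorsIn G (S - v))) {xs = colorsAt S v}
    (∈-deduplicate⁻ _≟_ _ a∈)

  privateCount : Subset n → Fin n → ℕ
  privateCount S v = length (privateColorsAt S v)

  cIn-delete : ∀ S v → cIn G S ≤ cIn G (S - v) + privateCount S v
  cIn-delete S v =
    ≤-trans (distinct-mono sorted) (distinct-++ (edgeColorsIn G (S - v)) (filter private? (colorsAt S v)))
    where
    private? = λ a → ¬? (a ∈ₗ? edgeColorsIn G (S - v))
    sorted : edgeColorsIn G S ⊆ₗ edgeColorsIn G (S - v) ++ filter private? (colorsAt S v)
    sorted {a} a∈ with a ∈ₗ? edgeColorsIn G (S - v)
    ... | yes a∈′ = ∈-++⁺ˡ a∈′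
    ... | no  a∉  with ∈-edgeColorsIn⁻ {S} a∈
    ... | x , y , x∈S , y∈S , x≢y , xy≡a with x ≟ᶠ v | y ≟ᶠ v
    ... | yes refl | _        = ∈-++⁺ʳ _ (∈-filter⁺ private? (∈-colorsAt⁺ {S} y∈S xy≡a) a∉)
    ... | no _     | yes refl = ∈-++⁺ʳ _ (∈-filter⁺ private? (∈-colorsAt⁺ {S} x∈S (trans (col-sym G v x) xy≡a)) a∉)
    ... | no x≢v   | no y≢v   =
      ⊥-elim (a∉ (∈-edgeColorsIn⁺ {S - v} (x∈p∧x≢y⇒x∈p-y x∈S x≢v) (x∈p∧x≢y⇒x∈p-y y∈S y≢v) x≢y xy≡a))

  eIn+cIn-delete : ∀ S v →
    eIn G S + cIn G S ≤ (degreeIn S v + privateCount S v) + (eIn G (S - v) + cIn G (S - v))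
  eIn+cIn-delete S v = ≤-trans (+-mono-≤ (eIn-delete S v) (cIn-delete S v))
    (≤-reflexive (trans (interchange +-commutativeSemigroup (eIn G (S - v)) _ _ _)
                        (+-comm (eIn G (S - v) + cIn G (S - v)) _)))

  col≡just⇒≢ : ∀ {x y a} → col G x y ≡ just a → x ≢ y
  col≡just⇒≢ {x} xy≡a refl with () ← trans (sym (col-irr G x)) xy≡a

  -- some y ∈ S with col G v y ≡ just a, and v if there is none
  witness : Subset n → Fin n → ℕ → Fin n
  witness S v a = maybe id v (find (λ y → ≡-dec-Maybe _≟_ (col G v y) (just a)) (members S))

  witness-colorsAt : ∀ {S v a} → a ∈ₗ colorsAt S v → witness S v a ∈ S × col G v (witness S v a) ≡ just a
  witness-colorsAt {S} {v} {a} a∈ with ∈-colorsAt⁻ {S} a∈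
  ... | y , y∈S , vy≡a
    with find-just (λ y → ≡-dec-Maybe _≟_ (col G v y) (just a)) (lose (∈-members⁺ y∈S) vy≡a)
  ... | z , found , z∈ , vz≡a rewrite found = ∈-members⁻ z∈ , vz≡a

  edgeColorsIn-≤1 : ∀ S → ∣ S ∣ ≤ 1 → edgeColorsIn G S ≡ []
  edgeColorsIn-≤1 S ∣S∣≤1 with edgeColorsIn G S | ∈-edgeColorsIn⁻ {S}
  ... | []    | _     = refl
  ... | _ ∷ _ | edge⁻ with x , y , x∈S , y∈S , x≢y , _ ← edge⁻ (here refl) =
    ⊥-elim (<-irrefl refl (≤-trans (x≢y⇒2≤∣p∣ x≢y x∈S y∈S) ∣S∣≤1))

  degreeIn<∣S∣ : ∀ {S v} → v ∈ S → degreeIn S v < ∣ S ∣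
  degreeIn<∣S∣ {S} {v} v∈S = subst₂ _≤_ (+-comm (degreeIn S v) 1) (degreeIn+nonDegreeIn≡∣S∣ S v)
    (+-monoʳ-≤ (degreeIn S v)
      (length-≤-⊆ ([] ∷ []) λ { (here refl) → ∈-nonNeighborsIn⁺ v∈S (col-irr G v) }))

  eIn≤triangular : ∀ {s} S → ∣ S ∣ ≡ suc s → eIn G S ≤ triangular s
  eIn≤triangular {zero}  S ∣S∣≡1 rewrite edgeColorsIn-≤1 S (≤-reflexive ∣S∣≡1) = z≤n
  eIn≤triangular {suc s} S ∣S∣≡ with v , v∈S ← ∣p∣≡suc⇒Nonempty {p = S} ∣S∣≡ = ≤-trans (eIn-delete S v)
    (subst (eIn G (S - v) + degreeIn S v ≤_) (+-comm (triangular s) (suc s))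
      (+-mono-≤ (eIn≤triangular (S - v) (∣p∣≡suc⇒∣p-x∣≡ v∈S ∣S∣≡))
                (≤-pred (subst (degreeIn S v <_) ∣S∣≡ (degreeIn<∣S∣ v∈S)))))

  CompleteOn-⊆ : ∀ {S T} → CompleteOn G S → T ⊆ S → CompleteOn G T
  CompleteOn-⊆ complete T⊆S x y x∈T y∈T = complete x y (T⊆S x∈T) (T⊆S y∈T)

  CompleteOn-extend : ∀ {S v} → CompleteOn G (S - v) →
    (∀ {y} → y ∈ S → y ≢ v → ∃ λ a → col G v y ≡ just a) → CompleteOn G S
  CompleteOn-extend {S} {v} complete adjacent x y x∈S y∈S x≢y with x ≟ᶠ v | y ≟ᶠ v
  ... | yes refl | _        = adjacent y∈S (≢-sym x≢y)
  ... | no  x≢v  | yes refl = let a , vx≡a = adjacent x∈S x≢v in a , trans (col-sym G x v) vx≡a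
  ... | no  x≢v  | no  y≢v  = complete x y (x∈p∧x≢y⇒x∈p-y x∈S x≢v) (x∈p∧x≢y⇒x∈p-y y∈S y≢v) x≢y

  -- Splits

  record Split (S : Subset n) : Set where
    field
      left right     : Subset n
      left-nonempty  : Nonempty left
      right-nonempty : Nonempty right
      disjoint       : Disjoint left right
      cover          : left ∪ right ≡ S
      mono           : MonoBetween G left right

    left⊆S : left ⊆ S
    left⊆S x∈ = subst (_ ∈_) cover (x∈p∪q⁺ (inj₁ x∈))

    right⊆S : right ⊆ S
    right⊆S x∈ = subst (_ ∈_) cover (x∈p∪q⁺ (inj₂ x∈))

    S⊆left⊎right : ∀ {x} → x ∈ S → x ∈ left ⊎ x ∈ right
    S⊆left⊎right x∈ = x∈p∪q⁻ left right (subst (_ ∈_) (sym cover) x∈)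

  Split-swap : ∀ {S} → Split S → Split S
  Split-swap σ = record
    { left = right ; right = left ; left-nonempty = right-nonempty ; right-nonempty = left-nonempty
    ; disjoint = λ x x∈r x∈l → disjoint x x∈l x∈r
    ; cover = trans (∪-comm right left) cover
    ; mono = let a , mono-a = mono in a , λ x y x∈r y∈l → trans (col-sym G x y) (mono-a y x y∈l x∈r) }
    where open Split σ

  suc-cIn-Split : ∀ {S} (σ : Split S) → suc (cIn G S) ≤ suc (cIn G (Split.left σ)) + suc (cIn G (Split.right σ))
  suc-cIn-Split {S} σ = s≤s (≤-trans (distinct-mono sorted)
    (≤-trans (distinct-++ (edgeColorsIn G left) _)
      (+-monoʳ-≤ (cIn G left) (≤-trans (distinct-++ (edgeColorsIn G right) (a ∷ [])) (≤-reflexive (+-comm _ 1))))))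
    where
    open Split σ
    a = proj₁ mono
    sorted : edgeColorsIn G S ⊆ₗ edgeColorsIn G left ++ edgeColorsIn G right ++ a ∷ []
    sorted c∈ with ∈-edgeColorsIn⁻ {S} c∈
    ... | x , y , x∈S , y∈S , x≢y , xy≡c with S⊆left⊎right x∈S | S⊆left⊎right y∈S
    ... | inj₁ x∈l | inj₁ y∈l = ∈-++⁺ˡ (∈-edgeColorsIn⁺ {left} x∈l y∈l x≢y xy≡c)
    ... | inj₂ x∈r | inj₂ y∈r = ∈-++⁺ʳ (edgeColorsIn G left) (∈-++⁺ˡ (∈-edgeColorsIn⁺ {right} x∈r y∈r x≢y xy≡c))
    ... | inj₁ x∈l | inj₂ y∈r = ∈-++⁺ʳ (edgeColorsIn G left) (∈-++⁺ʳ (edgeColorsIn G right)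
          (here (just-injective (trans (sym xy≡c) (proj₂ mono x y x∈l y∈r)))))
    ... | inj₂ x∈r | inj₁ y∈l = ∈-++⁺ʳ (edgeColorsIn G left) (∈-++⁺ʳ (edgeColorsIn G right)
          (here (just-injective (trans (sym xy≡c) (trans (col-sym G x y) (proj₂ mono y x y∈l x∈r))))))

  colorClass : Fin n → ℕ → Subset n
  colorClass v a = tabulate (λ y → isYes (≡-dec-Maybe _≟_ (col G v y) (just a)))

  ∈-colorClass⁺ : ∀ {v a y} → col G v y ≡ just a → y ∈ colorClass v a
  ∈-colorClass⁺ {y = y} vy≡a = lookup⇒[]= y _ (trans (lookup∘tabulate _ y) (Equivalence.to T-≡ (fromWitness vy≡a)))

  ∈-colorClass⁻ : ∀ {v a y} → y ∈ colorClass v a → col G v y ≡ just a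
  ∈-colorClass⁻ {y = y} y∈ = toWitness (Equivalence.from T-≡ (trans (sym (lookup∘tabulate _ y)) ([]=⇒lookup y∈)))

  ColorMaximal : Subset n → Set
  ColorMaximal S = suc (cIn G S) ≡ ∣ S ∣

  -- Graphs without rainbow triangles

  module _ (noRT : ¬ RainbowTriangle G) where

    -- the color c of y₁y₂ occurs in G[S - v], so it is neither a₁ nor a₂ and v y₁ y₂ would be rainbow
    privateColors-nonadjacent : ∀ {S v a₁ a₂ y₁ y₂} →
      a₁ ∉ₗ edgeColorsIn G (S - v) → a₂ ∉ₗ edgeColorsIn G (S - v) → a₁ ≢ a₂ →
      y₁ ∈ S → col G v y₁ ≡ just a₁ → y₂ ∈ S → col G v y₂ ≡ just a₂ → col G y₁ y₂ ≡ nothing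
    privateColors-nonadjacent {S} {v} {a₁} {a₂} {y₁} {y₂} a₁∉ a₂∉ a₁≢a₂ y₁∈S vy₁≡a₁ y₂∈S vy₂≡a₂
      with col G y₁ y₂ in y₁y₂≡c
    ... | nothing = refl
    ... | just c  = ⊥-elim (noRT (v , y₁ , y₂ , a₁ , c , a₂ , vy₁≡a₁ , y₁y₂≡c , vy₂≡a₂ ,
                                  (λ { refl → a₁∉ c∈ }) , (λ { refl → a₂∉ c∈ }) , a₁≢a₂))
      where
      c∈ : c ∈ₗ edgeColorsIn G (S - v)
      c∈ = ∈-edgeColorsIn⁺ {S - v} (x∈p∧x≢y⇒x∈p-y y₁∈S (≢-sym (col≡just⇒≢ vy₁≡a₁)))
             (x∈p∧x≢y⇒x∈p-y y₂∈S (≢-sym (col≡just⇒≢ vy₂≡a₂))) (col≡just⇒≢ y₁y₂≡c) y₁y₂≡c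

    privateCount≤nonDegreeIn : ∀ {S v} → v ∈ S → ∃ λ x → x ∈ S × privateCount S v ≤ nonDegreeIn S x
    privateCount≤nonDegreeIn {S} {v} v∈S
      with privateColorsAt S v | privateColorsAt-unique S v | ∈-privateColorsAt⁻ {S} {v}
    ... | []     | _       | _        = v , v∈S , z≤n
    ... | b ∷ bs | !b∷bs   | private⁻ = x , x∈S , length-≤-injection (witness S v) !b∷bs injective into
      where
      spec : ∀ {a} → a ∈ₗ b ∷ bs → witness S v a ∈ S × col G v (witness S v a) ≡ just a
      spec a∈ = witness-colorsAt {S} (proj₁ (private⁻ a∈))
      x = witness S v b
      x∈S = proj₁ (spec (here refl))
      injective : ∀ {a a′} → a ∈ₗ b ∷ bs → a′ ∈ₗ b ∷ bs → witness S v a ≡ witness S v a′ → a ≡ a′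
      injective a∈ a′∈ same =
        just-injective (trans (sym (proj₂ (spec a∈))) (trans (cong (col G v) same) (proj₂ (spec a′∈))))
      into : ∀ {a} → a ∈ₗ b ∷ bs → witness S v a ∈ₗ nonNeighborsIn S x
      into {a} a∈ with a ≟ b
      ... | yes refl = ∈-nonNeighborsIn⁺ x∈S (col-irr G x)
      ... | no  a≢b  = ∈-nonNeighborsIn⁺ (proj₁ (spec a∈))
        (privateColors-nonadjacent (proj₂ (private⁻ (here refl))) (proj₂ (private⁻ a∈)) (≢-sym a≢b)
          x∈S (proj₂ (spec (here refl))) (proj₁ (spec a∈)) (proj₂ (spec a∈)))

    -- take v of maximal non-degree: its private colors inject into the non-neighbors of some x
    bestVertex : ∀ {S} → Nonempty S → ∃ λ v → v ∈ S × degreeIn S v + privateCount S v ≤ ∣ S ∣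
    bestVertex {S} (v₀ , v₀∈S) = m , m∈S ,
      subst (degreeIn S m + privateCount S m ≤_) (degreeIn+nonDegreeIn≡∣S∣ S m) (+-monoʳ-≤ (degreeIn S m) k≤t)
      where
      m = argmax (nonDegreeIn S) v₀ (members S)
      m∈S : m ∈ S
      m∈S = argmax-all (nonDegreeIn S) {P = _∈ S} v₀∈S (All-tabulate ∈-members⁻)
      t≤t : ∀ {x} → x ∈ S → nonDegreeIn S x ≤ nonDegreeIn S m
      t≤t x∈S = All-lookup (f[xs]≤f[argmax] {f = nonDegreeIn S} v₀ (members S)) (∈-members⁺ x∈S)
      k≤t : privateCount S m ≤ nonDegreeIn S m
      k≤t = let _ , x∈S , k≤tₓ = privateCount≤nonDegreeIn m∈S in ≤-trans k≤tₓ (t≤t x∈S)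

    eIn+cIn<triangular : ∀ {s} S → ∣ S ∣ ≡ suc s → eIn G S + cIn G S < triangular (suc s)
    eIn+cIn<triangular {zero}  S ∣S∣≡1 rewrite edgeColorsIn-≤1 S (≤-reflexive ∣S∣≡1) = s≤s z≤n
    eIn+cIn<triangular {suc s} S ∣S∣≡ =
      let v , v∈S , d+k≤ = bestVertex {S} (∣p∣≡suc⇒Nonempty {p = S} ∣S∣≡) in
      ≤-<-trans (eIn+cIn-delete S v)
        (+-mono-≤-< (subst (degreeIn S v + privateCount S v ≤_) ∣S∣≡ d+k≤)
                    (eIn+cIn<triangular (S - v) (∣p∣≡suc⇒∣p-x∣≡ v∈S ∣S∣≡)))

    privateColor-unique : ∀ {S v a₁ a₂} → CompleteOn G (S - v) →
      a₁ ∈ₗ colorsAt S v → a₂ ∈ₗ colorsAt S v → a₁ ∉ₗ edgeColorsIn G (S - v) → a₂ ∉ₗ edgeColorsIn G (S - v) →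
      a₁ ≡ a₂
    privateColor-unique {S} {v} {a₁} {a₂} complete a₁∈ a₂∈ a₁∉ a₂∉ with a₁ ≟ a₂
    ... | yes a₁≡a₂ = a₁≡a₂
    ... | no  a₁≢a₂ = ⊥-elim (nothing≢just (trans (sym nonadjacent) (proj₂ adjacent)))
      where
      nothing≢just : ∀ {a : ℕ} → nothing ≢ just a
      nothing≢just ()
      y₁ = witness S v a₁
      y₂ = witness S v a₂
      y₁∈S = proj₁ (witness-colorsAt {S} a₁∈)
      vy₁≡a₁ = proj₂ (witness-colorsAt {S} a₁∈)
      y₂∈S = proj₁ (witness-colorsAt {S} a₂∈)
      vy₂≡a₂ = proj₂ (witness-colorsAt {S} a₂∈)
      ∈S-v : ∀ {y a} → y ∈ S → col G v y ≡ just a → y ∈ S - v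
      ∈S-v y∈S vy≡a = x∈p∧x≢y⇒x∈p-y y∈S (≢-sym (col≡just⇒≢ vy≡a))
      y₁≢y₂ : y₁ ≢ y₂
      y₁≢y₂ y₁≡y₂ = a₁≢a₂ (just-injective (trans (sym vy₁≡a₁) (trans (cong (col G v) y₁≡y₂) vy₂≡a₂)))
      nonadjacent = privateColors-nonadjacent a₁∉ a₂∉ a₁≢a₂ y₁∈S vy₁≡a₁ y₂∈S vy₂≡a₂
      adjacent = complete y₁ y₂ (∈S-v y₁∈S vy₁≡a₁) (∈S-v y₂∈S vy₂≡a₂) y₁≢y₂

    privateCount≤1 : ∀ {S v} → CompleteOn G (S - v) → privateCount S v ≤ 1
    privateCount≤1 {S} {v} complete
      with privateColorsAt S v | privateColorsAt-unique S v | ∈-privateColorsAt⁻ {S} {v}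
    ... | []          | _                 | _        = z≤n
    ... | _ ∷ []      | _                 | _        = s≤s z≤n
    ... | _ ∷ _ ∷ _   | (a₁≢a₂ ∷ _) ∷ _ | private⁻ =
      let a₁∈ , a₁∉ = private⁻ (here refl) ; a₂∈ , a₂∉ = private⁻ (there (here refl))
      in ⊥-elim (a₁≢a₂ (privateColor-unique complete a₁∈ a₂∈ a₁∉ a₂∉))

    tight-delete : ∀ {s S v} → v ∈ S → ∣ S ∣ ≡ suc (suc s) → degreeIn S v + privateCount S v ≤ ∣ S ∣ →
      suc (eIn G S + cIn G S) ≡ triangular (suc (suc s)) →
      suc (eIn G (S - v) + cIn G (S - v)) ≡ triangular (suc s) × privateCount S v ≡ nonDegreeIn S v
    tight-delete {s} {S} {v} v∈S ∣S∣≡ d+k≤ tight =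
      proj₂ both ,
      +-cancelˡ-≡ (degreeIn S v) _ _ (trans (proj₁ both) (sym (trans (degreeIn+nonDegreeIn≡∣S∣ S v) ∣S∣≡)))
      where
      both = +-tight (subst (degreeIn S v + privateCount S v ≤_) ∣S∣≡ d+k≤)
        (eIn+cIn<triangular (S - v) (∣p∣≡suc⇒∣p-x∣≡ v∈S ∣S∣≡))
        (subst (_≤ degreeIn S v + privateCount S v + suc (eIn G (S - v) + cIn G (S - v))) tight
          (≤-trans (s≤s (eIn+cIn-delete S v)) (≤-reflexive (sym (+-suc _ _)))))

    tight⇒CompleteOn : ∀ {s} S → ∣ S ∣ ≡ suc s → suc (eIn G S + cIn G S) ≡ triangular (suc s) → CompleteOn G S
    tight⇒CompleteOn {zero}  S ∣S∣≡1 _ x y x∈S y∈S x≢y =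
      ⊥-elim (<-irrefl refl (≤-trans (x≢y⇒2≤∣p∣ x≢y x∈S y∈S) (≤-reflexive ∣S∣≡1)))
    tight⇒CompleteOn {suc s} S ∣S∣≡ tight =
      let v , v∈S , d+k≤ = bestVertex {S} (∣p∣≡suc⇒Nonempty {p = S} ∣S∣≡) in
      tight-extend v∈S (tight-delete {s} {S} {v} v∈S ∣S∣≡ d+k≤ tight)
      where
      tight-extend : ∀ {v} → v ∈ S →
        suc (eIn G (S - v) + cIn G (S - v)) ≡ triangular (suc s) × privateCount S v ≡ nonDegreeIn S v →
        CompleteOn G S
      tight-extend {v} v∈S (tight′ , k≡t) = CompleteOn-extend complete′ adjacent
        where
        complete′ = tight⇒CompleteOn (S - v) (∣p∣≡suc⇒∣p-x∣≡ v∈S ∣S∣≡) tight′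
        -- a non-neighbor y of v would give two non-neighbors, but at most one private color
        adjacent : ∀ {y} → y ∈ S → y ≢ v → ∃ λ a → col G v y ≡ just a
        adjacent {y} y∈S y≢v with col G v y in vy≡
        ... | just a  = a , refl
        ... | nothing =
          ⊥-elim (<-irrefl refl (≤-trans 2≤t (≤-trans (≤-reflexive (sym k≡t)) (privateCount≤1 complete′))))
          where
          2≤t : 2 ≤ nonDegreeIn S v
          2≤t = length-≤-⊆ ((≢-sym y≢v ∷ []) ∷ [] ∷ [])
            λ { (here refl) → ∈-nonNeighborsIn⁺ v∈S (col-irr G v) ; (there (here refl)) → ∈-nonNeighborsIn⁺ y∈S vy≡ }

    CompleteOn⇒cIn≤ : ∀ S {s} → ∣ S ∣ ≡ suc s → CompleteOn G S → cIn G S ≤ s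
    CompleteOn⇒cIn≤ S {zero}  ∣S∣≡1 _ rewrite edgeColorsIn-≤1 S (≤-reflexive ∣S∣≡1) = z≤n
    CompleteOn⇒cIn≤ S {suc s} ∣S∣≡ complete with v , v∈S ← ∣p∣≡suc⇒Nonempty {p = S} ∣S∣≡ =
      ≤-trans (cIn-delete S v)
        (subst (cIn G (S - v) + privateCount S v ≤_) (+-comm s 1)
          (+-mono-≤ (CompleteOn⇒cIn≤ (S - v) (∣p∣≡suc⇒∣p-x∣≡ v∈S ∣S∣≡) complete′)
                    (privateCount≤1 complete′)))
      where complete′ = CompleteOn-⊆ complete (p─q⊆p S ⁅ v ⁆)

    CompleteOn⇒cIn<∣S∣ : ∀ {S} → CompleteOn G S → Nonempty S → cIn G S < ∣ S ∣
    CompleteOn⇒cIn<∣S∣ {S} complete (_ , x∈S) with ∣ S ∣ in ∣S∣≡ | x∈p⇒1≤∣p∣ x∈S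
    ... | suc _ | _ = s≤s (CompleteOn⇒cIn≤ S ∣S∣≡ complete)

    tight⇒ColorMaximal : ∀ {s} S → ∣ S ∣ ≡ suc s → suc (eIn G S + cIn G S) ≡ triangular (suc s) → ColorMaximal S
    tight⇒ColorMaximal {s} S ∣S∣≡ tight = trans (proj₁ (+-tight
      (subst (cIn G S <_) ∣S∣≡ (CompleteOn⇒cIn<∣S∣ (tight⇒CompleteOn S ∣S∣≡ tight) (∣p∣≡suc⇒Nonempty {p = S} ∣S∣≡)))
      (eIn≤triangular S ∣S∣≡)
      (≤-reflexive (trans (sym tight) (cong suc (+-comm (eIn G S) (cIn G S))))))) (sym ∣S∣≡)

    privateColor : ∀ {S v} → CompleteOn G S → ColorMaximal S → v ∈ S → Nonempty (S - v) →
      ∃ λ p → p ∈ₗ colorsAt S v × p ∉ₗ edgeColorsIn G (S - v)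
    privateColor {S} {v} complete maximal v∈S nonempty
      with privateColorsAt S v | cIn-delete S v | ∈-privateColorsAt⁻ {S} {v}
    ... | p ∷ _ | _    | private⁻ = p , private⁻ (here refl)
    ... | []    | c≤c′ | _        = ⊥-elim (<-irrefl refl (≤-<-trans ∣S-v∣≤c′
        (CompleteOn⇒cIn<∣S∣ (CompleteOn-⊆ complete (p─q⊆p S ⁅ v ⁆)) nonempty)))
      where
      ∣S-v∣≤c′ : ∣ S - v ∣ ≤ cIn G (S - v)
      ∣S-v∣≤c′ = subst (_≤ cIn G (S - v)) (suc-injective (trans maximal (sym (x∈p⇒suc∣p-x∣≡∣p∣ v∈S))))
        (≤-trans c≤c′ (≤-reflexive (+-identityʳ _)))

    -- x carries the private color p towards v, so a third color on xy would make v x y rainbow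
    col-across-privateClass : ∀ {S v p x y} → CompleteOn G S → p ∉ₗ edgeColorsIn G (S - v) → v ∈ S →
      x ∈ S → col G v x ≡ just p → y ∈ S → y ≢ v → col G v y ≢ just p → x ≢ y → col G x y ≡ col G v y
    col-across-privateClass {S} {v} {p} {x} {y} complete p∉ v∈S x∈S vx≡p y∈S y≢v vy≢p x≢y
      with complete v y v∈S y∈S (≢-sym y≢v) | complete x y x∈S y∈S x≢y
    ... | q , vy≡q | c , xy≡c with c ≟ q
    ... | yes refl = trans xy≡c (sym vy≡q)
    ... | no  c≢q  = ⊥-elim (noRT (v , x , y , p , c , q , vx≡p , xy≡c , vy≡q , p≢c , c≢q , λ { refl → vy≢p vy≡q }))
      where
      p≢c : p ≢ c
      p≢c refl = p∉ (∈-edgeColorsIn⁺ {S - v} (x∈p∧x≢y⇒x∈p-y x∈S (≢-sym (col≡just⇒≢ vx≡p)))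
                                             (x∈p∧x≢y⇒x∈p-y y∈S y≢v) x≢y xy≡c)

    module PrivateClass {S v p} (complete : CompleteOn G S) (v∈S : v ∈ S)
                        (p∈ : p ∈ₗ colorsAt S v) (p∉ : p ∉ₗ edgeColorsIn G (S - v)) where

      N A B : Subset n
      N = S ∩ colorClass v p
      A = S ─ colorClass v p
      B = N ∪ ⁅ v ⁆

      N⊆S : N ⊆ S
      N⊆S = proj₁ ∘ x∈p∩q⁻ S (colorClass v p)

      A⊆S : A ⊆ S
      A⊆S = p─q⊆p S (colorClass v p)

      B⊆S : B ⊆ S
      B⊆S x∈B = [ N⊆S , (λ x∈⁅v⁆ → subst (_∈ S) (sym (x∈⁅y⁆⇒x≡y v x∈⁅v⁆)) v∈S) ]′ (x∈p∪q⁻ N ⁅ v ⁆ x∈B)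

      v∈A : v ∈ A
      v∈A = x∈p∧x∉q⇒x∈p─q v∈S λ v∈C → col≡just⇒≢ (∈-colorClass⁻ v∈C) refl

      v∈B : v ∈ B
      v∈B = x∈p∪q⁺ (inj₂ (x∈⁅x⁆ v))

      N⊆B : N ⊆ B
      N⊆B = x∈p∪q⁺ ∘ inj₁

      N-nonempty : Nonempty N
      N-nonempty = let y∈S , vy≡p = witness-colorsAt {S} p∈ in _ , x∈p∩q⁺ (y∈S , ∈-colorClass⁺ vy≡p)

      N-A-disjoint : Disjoint N A
      N-A-disjoint _ x∈N x∈A = x∈p─q⇒x∉q x∈A (proj₂ (x∈p∩q⁻ S _ x∈N))

      S⊆N⊎A : ∀ {x} → x ∈ S → x ∈ N ⊎ x ∈ A
      S⊆N⊎A {x} x∈S with x ∈? colorClass v p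
      ... | yes x∈C = inj₁ (x∈p∩q⁺ (x∈S , x∈C))
      ... | no  x∉C = inj₂ (x∈p∧x∉q⇒x∈p─q x∈S x∉C)

      col-N-A : ∀ {x y} → x ∈ N → y ∈ A → y ≢ v → col G x y ≡ col G v y
      col-N-A {x} {y} x∈N y∈A y≢v = col-across-privateClass complete p∉ v∈S (N⊆S x∈N)
        (∈-colorClass⁻ (proj₂ (x∈p∩q⁻ S _ x∈N))) (A⊆S y∈A) y≢v
        (λ vy≡p → x∈p─q⇒x∉q y∈A (∈-colorClass⁺ vy≡p)) (λ { refl → N-A-disjoint x x∈N y∈A })

      edgeColorsIn-N-A : ∀ {x y c} → x ∈ N → y ∈ A → x ≢ y → col G x y ≡ just c →
        c ∈ₗ edgeColorsIn G A ++ edgeColorsIn G B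
      edgeColorsIn-N-A {x} {y} x∈N y∈A x≢y xy≡c with y ≟ᶠ v
      ... | yes refl = ∈-++⁺ʳ (edgeColorsIn G A) (∈-edgeColorsIn⁺ {B} (N⊆B x∈N) v∈B x≢y xy≡c)
      ... | no  y≢v  = ∈-++⁺ˡ (∈-edgeColorsIn⁺ {A} v∈A y∈A (≢-sym y≢v) (trans (sym (col-N-A x∈N y∈A y≢v)) xy≡c))

      edgeColorsIn-S⊆A++B : edgeColorsIn G S ⊆ₗ edgeColorsIn G A ++ edgeColorsIn G B
      edgeColorsIn-S⊆A++B c∈ with ∈-edgeColorsIn⁻ {S} c∈
      ... | x , y , x∈S , y∈S , x≢y , xy≡c with S⊆N⊎A x∈S | S⊆N⊎A y∈S
      ... | inj₁ x∈N | inj₁ y∈N = ∈-++⁺ʳ (edgeColorsIn G A) (∈-edgeColorsIn⁺ {B} (N⊆B x∈N) (N⊆B y∈N) x≢y xy≡c)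
      ... | inj₂ x∈A | inj₂ y∈A = ∈-++⁺ˡ (∈-edgeColorsIn⁺ {A} x∈A y∈A x≢y xy≡c)
      ... | inj₁ x∈N | inj₂ y∈A = edgeColorsIn-N-A x∈N y∈A x≢y xy≡c
      ... | inj₂ x∈A | inj₁ y∈N = edgeColorsIn-N-A y∈N x∈A (≢-sym x≢y) (trans (col-sym G y x) xy≡c)

      -- c(S) ≤ c(A) + c(B) with c(B) ≤ ∣ N ∣ leaves no room below ∣ A ∣ - 1 colors in A
      A-maximal : ColorMaximal S → ColorMaximal A
      A-maximal maximal = ≤-antisym (CompleteOn⇒cIn<∣S∣ (CompleteOn-⊆ complete A⊆S) (v , v∈A))
        (+-cancelʳ-≤ ∣ N ∣ ∣ A ∣ (suc (cIn G A)) (begin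
          ∣ A ∣ + ∣ N ∣                 ≤⟨ Disjoint⇒∣p∣+∣q∣≤∣r∣ (λ x x∈A x∈N → N-A-disjoint x x∈N x∈A) A⊆S N⊆S ⟩
          ∣ S ∣                         ≡⟨ sym maximal ⟩
          suc (cIn G S)                 ≤⟨ s≤s (≤-trans (distinct-mono edgeColorsIn-S⊆A++B)
                                                        (distinct-++ (edgeColorsIn G A) (edgeColorsIn G B))) ⟩
          suc (cIn G A + cIn G B)       ≤⟨ s≤s (+-monoʳ-≤ (cIn G A) cB≤∣N∣) ⟩
          suc (cIn G A) + ∣ N ∣         ∎))
        where
        open ≤-Reasoning
        cB≤∣N∣ : cIn G B ≤ ∣ N ∣
        cB≤∣N∣ = ≤-pred (≤-trans (CompleteOn⇒cIn<∣S∣ (CompleteOn-⊆ complete B⊆S) (v , v∈B))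
          (≤-trans (∣p∪q∣≤∣p∣+∣q∣ N ⁅ v ⁆) (≤-reflexive (trans (cong (∣ N ∣ +_) (∣⁅x⁆∣≡1 v)) (+-comm ∣ N ∣ 1)))))

      ∣A∣<∣S∣ : ∣ A ∣ < ∣ S ∣
      ∣A∣<∣S∣ = ≤-trans (subst (_≤ ∣ A ∣ + ∣ N ∣) (+-comm ∣ A ∣ 1) (+-monoʳ-≤ ∣ A ∣ (x∈p⇒1≤∣p∣ (proj₂ N-nonempty))))
        (Disjoint⇒∣p∣+∣q∣≤∣r∣ (λ x x∈A x∈N → N-A-disjoint x x∈N x∈A) A⊆S N⊆S)

      Split-singleton : ∣ A ∣ ≤ 1 → Split S
      Split-singleton ∣A∣≤1 = record
        { left = A ; right = N ; left-nonempty = v , v∈A ; right-nonempty = N-nonempty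
        ; disjoint = λ x x∈A x∈N → N-A-disjoint x x∈N x∈A
        ; cover = p∪q≡r A⊆S N⊆S (swap ∘ S⊆N⊎A)
        ; mono = p , λ x y x∈A y∈N →
            subst (λ z → col G z y ≡ just p) (sym (x≡v x∈A)) (∈-colorClass⁻ (proj₂ (x∈p∩q⁻ S _ y∈N))) }
        where
        x≡v : ∀ {x} → x ∈ A → x ≡ v
        x≡v {x} x∈A with x ≟ᶠ v
        ... | yes x≡v = x≡v
        ... | no  x≢v = ⊥-elim (<-irrefl refl (≤-trans (x≢y⇒2≤∣p∣ x≢v x∈A v∈A) ∣A∣≤1))

      Split-extend : (σ : Split A) → v ∈ Split.left σ → Split S
      Split-extend σ v∈A₁ = record
        { left = A₁ ∪ N ; right = A₂
        ; left-nonempty = let x , x∈ = A₁-nonempty in x , x∈p∪q⁺ (inj₁ x∈)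
        ; right-nonempty = A₂-nonempty
        ; disjoint = λ x x∈A₁∪N x∈A₂ →
            [ (λ x∈A₁ → A-disjoint x x∈A₁ x∈A₂) , (λ x∈N → N-A-disjoint x x∈N (A₂⊆A x∈A₂)) ]′ (x∈p∪q⁻ A₁ N x∈A₁∪N)
        ; cover = p∪q≡r (λ x∈ → [ A⊆S ∘ A₁⊆A , N⊆S ]′ (x∈p∪q⁻ A₁ N x∈)) (A⊆S ∘ A₂⊆A)
            (λ x∈S → [ inj₁ ∘ x∈p∪q⁺ ∘ inj₂ , ⊎-map₁ (x∈p∪q⁺ ∘ inj₁) ∘ A⊆A₁⊎A₂ ]′ (S⊆N⊎A x∈S))
        ; mono = a , λ x y x∈ y∈A₂ →
            [ (λ x∈A₁ → mono-a x y x∈A₁ y∈A₂)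
            , (λ x∈N → trans (col-N-A x∈N (A₂⊆A y∈A₂) (λ { refl → A-disjoint v v∈A₁ y∈A₂ })) (mono-a v y v∈A₁ y∈A₂))
            ]′ (x∈p∪q⁻ A₁ N x∈) }
        where
        open Split σ renaming (left to A₁; right to A₂; left-nonempty to A₁-nonempty; right-nonempty to A₂-nonempty;
          disjoint to A-disjoint; left⊆S to A₁⊆A; right⊆S to A₂⊆A; S⊆left⊎right to A⊆A₁⊎A₂)
        a = proj₁ mono
        mono-a = proj₂ mono

      Split-from : ColorMaximal S →
        (∀ {T} → ∣ T ∣ < ∣ S ∣ → CompleteOn G T → ColorMaximal T → 2 ≤ ∣ T ∣ → Split T) → Split S
      Split-from maximal split-smaller with ∣ A ∣ ≤? 1
      ... | yes ∣A∣≤1 = Split-singleton ∣A∣≤1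
      ... | no  ∣A∣≰1 =
        let σ = split-smaller ∣A∣<∣S∣ (CompleteOn-⊆ complete A⊆S) (A-maximal maximal) (≰⇒> ∣A∣≰1)
        in [ Split-extend σ , Split-extend (Split-swap σ) ]′ (Split.S⊆left⊎right σ v∈A)

    ColorMaximal⇒Split : ∀ S → Acc _<_ ∣ S ∣ → CompleteOn G S → ColorMaximal S → 2 ≤ ∣ S ∣ → Split S
    ColorMaximal⇒Split S (acc rec) complete maximal 2≤∣S∣
      with v , v∈S ← 0<∣p∣⇒Nonempty {p = S} (≤-trans (s≤s z≤n) 2≤∣S∣)
      with p , p∈ , p∉ ← privateColor complete maximal v∈S
             (0<∣p∣⇒Nonempty (≤-pred (subst (2 ≤_) (sym (x∈p⇒suc∣p-x∣≡∣p∣ v∈S)) 2≤∣S∣))) =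
      PrivateClass.Split-from complete v∈S p∈ p∉ maximal
        (λ {T} ∣T∣<∣S∣ → ColorMaximal⇒Split T (rec ∣T∣<∣S∣))

    InG0-Split : ∀ {S} (σ : Split S) → CompleteOn G S → ColorMaximal S →
      (∀ {T} → ∣ T ∣ < ∣ S ∣ → CompleteOn G T → ColorMaximal T → InG0 G T) → InG0 G S
    InG0-Split {S} σ complete maximal inG0-smaller =
      split left right complete (cong (_∸ 1) maximal) left-nonempty right-nonempty disjoint cover mono
        (inG0-smaller ∣left∣<∣S∣ left-complete (proj₁ maximal-parts))
        (inG0-smaller ∣right∣<∣S∣ right-complete (proj₂ maximal-parts))
      where
      open Split σ
      left-complete = CompleteOn-⊆ complete left⊆S
      right-complete = CompleteOn-⊆ complete right⊆S
      ∣left∣+∣right∣≤∣S∣ = Disjoint⇒∣p∣+∣q∣≤∣r∣ disjoint left⊆S right⊆S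
      maximal-parts = +-tight (CompleteOn⇒cIn<∣S∣ left-complete left-nonempty)
        (CompleteOn⇒cIn<∣S∣ right-complete right-nonempty)
        (≤-trans ∣left∣+∣right∣≤∣S∣ (subst (_≤ _) maximal (suc-cIn-Split σ)))
      ∣left∣<∣S∣ : ∣ left ∣ < ∣ S ∣
      ∣left∣<∣S∣ = ≤-trans (subst (_≤ ∣ left ∣ + ∣ right ∣) (+-comm ∣ left ∣ 1)
        (+-monoʳ-≤ ∣ left ∣ (x∈p⇒1≤∣p∣ (proj₂ right-nonempty)))) ∣left∣+∣right∣≤∣S∣
      ∣right∣<∣S∣ : ∣ right ∣ < ∣ S ∣
      ∣right∣<∣S∣ = ≤-trans (+-monoˡ-≤ ∣ right ∣ (x∈p⇒1≤∣p∣ (proj₂ left-nonempty))) ∣left∣+∣right∣≤∣S∣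

    ColorMaximal⇒InG0 : ∀ S → Acc _<_ ∣ S ∣ → CompleteOn G S → ColorMaximal S → InG0 G S
    ColorMaximal⇒InG0 S (acc rec) complete maximal with ∣ S ∣ ≟ 1
    ... | yes ∣S∣≡1 = single ∣S∣≡1
    ... | no  ∣S∣≢1 = InG0-Split (ColorMaximal⇒Split S (acc rec) complete maximal 2≤∣S∣) complete maximal
        (λ {T} ∣T∣<∣S∣ → ColorMaximal⇒InG0 T (rec ∣T∣<∣S∣))
      where
      2≤∣S∣ : 2 ≤ ∣ S ∣
      2≤∣S∣ = ≤∧≢⇒< (subst (1 ≤_) maximal (s≤s z≤n)) (≢-sym ∣S∣≢1)

theorem2 : (n : ℕ) → 1 ≤ n → (G : ECGraph n) →
    e G + c G ≥ (suc n C 2) ∸ 1 → ¬ RainbowTriangle G → InG0Graph G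
theorem2 (suc s) _ G e+c≥ noRT =
  ColorMaximal⇒InG0 G noRT ⊤ (<-wellFounded ∣ ⊤ {suc s} ∣)
    (tight⇒CompleteOn G noRT ⊤ ∣⊤∣≡ tight) (tight⇒ColorMaximal G noRT ⊤ ∣⊤∣≡ tight)
  where
  ∣⊤∣≡ : ∣ ⊤ {suc s} ∣ ≡ suc s
  ∣⊤∣≡ = ∣⊤∣≡n (suc s)
  tight : suc (e G + c G) ≡ triangular (suc s)
  tight = ≤-antisym (eIn+cIn<triangular G noRT ⊤ ∣⊤∣≡)
    (s≤s (subst (λ t → t ∸ 1 ≤ e G + c G) (sym (triangular≡C (suc s))) e+c≥))
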